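{- Let $S\subset\mathbb{N}$ be a finite set with $|S|\le 3$. Then Maker has an $|S|$-move strategy in the game for $S$.
   Context: Game for $S$: for a fixed finite set $S\subset\mathbb{N}$, two players, Maker and Breaker, alternately choose previously unchosen natural numbers, Maker choosing first. Maker wins as soon as the set of Maker's choices contains $aS+b$ for some $a\in\mathbb{N}\setminus\{0\}$ and $b\in\mathbb{Z}$. Maker has an $N$-move strategy if Maker has a strategy guaranteeing a win using at most $N$ selections, whatever Breaker does. -}

module Defs where

open import Data.Nat using (ℕ; zero; suc; _≥_)
open import Data.Integer as ℤ using (ℤ; +_)
open import Data.List using (List; []; _∷_)
open import Data.List.Membership.Propositional using (_∈_; _∉_)
open import Data.Product using (Σ; ∃; ∃-syntax; _×_)
open import Data.Sum using (_⊎_)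
open import Relation.Binary.PropositionalEquality using (_≡_; _≢_)

-- A finite set S ⊆ ℕ is represented by a list (the set of its elements).
-- `Contains S M` : the set M contains a·S + b for some a ∈ ℕ∖{0}, b ∈ ℤ,
-- i.e. for every s ∈ S, the integer a·s + b is (the image of) an element of M.
Contains : List ℕ → List ℕ → Set
Contains S M =
  ∃[ a ] (a ≥ 1 × ∃[ b ] (∀ {s} → s ∈ S →
     ∃[ m ] (m ∈ M × (+ m) ≡ (+ a) ℤ.* (+ s) ℤ.+ b)))

-- `WinsWithin S n M B` : in the game for S, in the position where Maker has
-- chosen the numbers in M, Breaker those in B, and it is Maker's turn,
-- Maker has a strategy guaranteeing a win using at most n further selections,
-- whatever Breaker does.
WinsWithin : List ℕ → ℕ → List ℕ → List ℕ → Set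
WinsWithin S zero    M B = Contains S M
WinsWithin S (suc n) M B =
  Contains S M ⊎
  ∃[ x ] (x ∉ M × x ∉ B ×
    (∀ y → y ≢ x → y ∉ M → y ∉ B → WinsWithin S n (x ∷ M) (y ∷ B)))

HasMoveStrategy : List ℕ → ℕ → Set
HasMoveStrategy S N = WinsWithin S N [] []

-- Whether Maker's set contains some aS + b is unchanged by translating S, so S may be
-- taken sorted with least element 0.  Maker opens with 0 and answers Breaker's move y
-- with multiples of k = y + 1, which exceed y.  For S = {0, A} the reply kA completes
-- kS.  For S = {0, A, D} the reply z = kAD lies in both kA·S = {0, kA², z} and
-- kD·S = {0, z, kD²}, and Breaker cannot block both kA² and kD² with one move.

module Submission where

open import Defs
open import Data.Nat using (ℕ; zero; suc; _≤_; _<_; _+_; _*_; _∸_; s≤s; NonZero; >-nonZero; >-nonZero⁻¹)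
open import Data.Nat.Properties
import Data.Integer as ℤ
import Data.Integer.Properties as ℤ
open import Data.Integer.Solver using (module +-*-Solver)
open import Data.List using (List; []; _∷_; length; map)
open import Data.List.Membership.Propositional using (_∈_; _∉_)
open import Data.List.Membership.Propositional.Properties using (∈-map⁺; ∈-map⁻)
open import Data.List.Relation.Binary.Subset.Propositional using (_⊆_)
open import Data.List.Relation.Binary.Permutation.Propositional using (_↭_; ↭-sym; ↭⇒↭ₛ)
open import Data.List.Relation.Binary.Permutation.Propositional.Properties using (∈-resp-↭; ↭-length)
open import Relation.Binary.PropositionalEquality
  using (_≡_; _≢_; refl; sym; trans; subst; ≢-sym; setoid)
open import Data.List.Relation.Binary.Permutation.Setoid.Properties (setoid ℕ) using (Unique-resp-↭)
open import Data.List.Relation.Unary.All as All using (All; []; _∷_)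
open import Data.List.Relation.Unary.All.Properties using (All¬⇒¬Any)
open import Data.List.Relation.Unary.AllPairs using (_∷_)
open import Data.List.Relation.Unary.Any using (here; there)
open import Data.List.Relation.Unary.Linked using (Linked; []; [-]; _∷_)
open import Data.List.Relation.Unary.Unique.Propositional using (Unique)
open import Data.List.Sort ≤-decTotalOrder using (sort; sort-↭; sort-↗)
open import Algebra.Properties.CommutativeSemigroup *-commutativeSemigroup using (xy∙z≈xz∙y)
open import Data.Product using (_,_; _×_; ∃-syntax)
open import Data.Sum using (inj₁; inj₂)
open import Relation.Nullary using (yes; no)

Contains-⊆ : ∀ {S S′ M} → S ⊆ S′ → Contains S′ M → Contains S M
Contains-⊆ S⊆S′ (a , a≥1 , b , copy) = a , a≥1 , b , λ s∈S → copy (S⊆S′ s∈S)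

Contains-dilate : ∀ {S M} a .{{_ : NonZero a}} → All (λ s → a * s ∈ M) S → Contains S M
Contains-dilate a aS⊆M = a , >-nonZero⁻¹ a , ℤ.+ 0 , λ {s} s∈S →
  a * s , All.lookup aS⊆M s∈S , trans (ℤ.pos-* a s) (sym (ℤ.+-identityʳ _))

Contains-translate : ∀ {S M} t → Contains S M → Contains (map (t +_) S) M
Contains-translate {S} {M} t (a , a≥1 , b , copy) = a , a≥1 , b ℤ.- (ℤ.+ a) ℤ.* (ℤ.+ t) , shifted
  where
  shift : ∀ a t x b → (ℤ.+ a) ℤ.* (ℤ.+ (t + x)) ℤ.+ (b ℤ.- (ℤ.+ a) ℤ.* (ℤ.+ t)) ≡ (ℤ.+ a) ℤ.* (ℤ.+ x) ℤ.+ b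
  shift a t x b rewrite ℤ.pos-+ t x =
    solve 4 (λ a t x b → a :* (t :+ x) :+ (b :- a :* t) := a :* x :+ b) refl (ℤ.+ a) (ℤ.+ t) (ℤ.+ x) b
    where open +-*-Solver

  shifted : ∀ {e} → e ∈ map (t +_) S →
            ∃[ m ] (m ∈ M × ℤ.+ m ≡ (ℤ.+ a) ℤ.* (ℤ.+ e) ℤ.+ (b ℤ.- (ℤ.+ a) ℤ.* (ℤ.+ t)))
  shifted e∈ with ∈-map⁻ (t +_) e∈
  ... | x , x∈S , refl with copy x∈S
  ...   | m , m∈M , m≡ax+b = m , m∈M , trans m≡ax+b (sym (shift a t x b))

WinsWithin-mono : ∀ {S S′} → (∀ {M} → Contains S′ M → Contains S M) →
                  ∀ {n M B} → WinsWithin S′ n M B → WinsWithin S n M B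
WinsWithin-mono weaken {zero}  c = weaken c
WinsWithin-mono weaken {suc n} (inj₁ c) = inj₁ (weaken c)
WinsWithin-mono weaken {suc n} (inj₂ (x , x∉M , x∉B , continue)) =
  inj₂ (x , x∉M , x∉B , λ y y≢x y∉M y∉B → WinsWithin-mono weaken (continue y y≢x y∉M y∉B))

WinsWithin-↭ : ∀ {S S′ n M B} → S ↭ S′ → WinsWithin S′ n M B → WinsWithin S n M B
WinsWithin-↭ S↭S′ = WinsWithin-mono (Contains-⊆ (∈-resp-↭ S↭S′))

translate-to-origin : ∀ {s xs n M B} → All (s ≤_) xs →
                      WinsWithin (0 ∷ map (_∸ s) xs) n M B → WinsWithin (s ∷ xs) n M B
translate-to-origin {s} {xs} s≤xs =
  WinsWithin-mono (λ c → Contains-⊆ ⊆-translated (Contains-translate s c))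
  where
  ⊆-translated : s ∷ xs ⊆ map (s +_) (0 ∷ map (_∸ s) xs)
  ⊆-translated (here refl) = here (sym (+-identityʳ s))
  ⊆-translated (there x∈xs) =
    there (subst (_∈ _) (m+[n∸m]≡n (All.lookup s≤xs x∈xs)) (∈-map⁺ (s +_) (∈-map⁺ (_∸ s) x∈xs)))

∉-∷ : ∀ {x y : ℕ} {L} → x ≢ y → x ∉ L → x ∉ y ∷ L
∉-∷ x≢y x∉L (here x≡y) = x≢y x≡y
∉-∷ x≢y x∉L (there x∈L) = x∉L x∈L

winning-move : ∀ {S M B} x → x ∉ M → x ∉ B → Contains S (x ∷ M) → WinsWithin S 1 M B
winning-move x x∉M x∉B c = inj₂ (x , x∉M , x∉B , λ _ _ _ _ → c)

double-threat : ∀ {S M B} u v → u ≢ v → u ∉ M → v ∉ M → u ∉ B → v ∉ B →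
                Contains S (u ∷ M) → Contains S (v ∷ M) → ∀ w → WinsWithin S 1 M (w ∷ B)
double-threat u v u≢v u∉M v∉M u∉B v∉B wins-u wins-v w with w ≟ u
... | no w≢u    = winning-move u u∉M (∉-∷ (≢-sym w≢u) u∉B) wins-u
... | yes refl  = winning-move v v∉M (∉-∷ (≢-sym u≢v) v∉B) wins-v

<1+m*n : ∀ m n .{{_ : NonZero n}} → m < suc m * n
<1+m*n m n = m≤m*n (suc m) n

wins-singleton : WinsWithin (0 ∷ []) 1 [] []
wins-singleton = winning-move 0 (λ ()) (λ ()) (Contains-dilate 1 (here refl ∷ []))

wins-pair : ∀ A .{{_ : NonZero A}} → WinsWithin (0 ∷ A ∷ []) 2 [] []
wins-pair A = inj₂ (0 , (λ ()) , (λ ()) , λ y _ _ _ → reply y)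
  where
  reply : ∀ y → WinsWithin (0 ∷ A ∷ []) 1 (0 ∷ []) (y ∷ [])
  reply y = winning-move (k * A)
    (All¬⇒¬Any (m<n⇒n≢0 y<kA ∷ [])) (All¬⇒¬Any (>⇒≢ y<kA ∷ []))
    (Contains-dilate k (there (here (*-zeroʳ k)) ∷ here refl ∷ []))
    where
    k : ℕ
    k = suc y

    y<kA : y < k * A
    y<kA = <1+m*n y A

wins-triple : ∀ A D .{{_ : NonZero A}} → A < D → WinsWithin (0 ∷ A ∷ D ∷ []) 3 [] []
wins-triple A D A<D = inj₂ (0 , (λ ()) , (λ ()) , λ y _ _ _ → reply y)
  where
  instance
    D≢0 : NonZero D
    D≢0 = >-nonZero (<-≤-trans (>-nonZero⁻¹ A) (<⇒≤ A<D))

  reply : ∀ y → WinsWithin (0 ∷ A ∷ D ∷ []) 2 (0 ∷ []) (y ∷ [])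
  reply y = inj₂ (z , All¬⇒¬Any (m<n⇒n≢0 y<z ∷ []) , All¬⇒¬Any (>⇒≢ y<z ∷ []) ,
                  λ w _ _ _ → double-threat kD² kA² (>⇒≢ (<-trans kA²<z z<kD²))
                    (All¬⇒¬Any (>⇒≢ z<kD² ∷ m<n⇒n≢0 y<kD² ∷ []))
                    (All¬⇒¬Any (<⇒≢ kA²<z ∷ m<n⇒n≢0 y<kA² ∷ []))
                    (All¬⇒¬Any (>⇒≢ y<kD² ∷ []))
                    (All¬⇒¬Any (>⇒≢ y<kA² ∷ []))
                    kD²-completes kA²-completes w)
    where
    k z kA² kD² : ℕ
    k = suc y
    z = k * A * D
    kA² = k * A * A
    kD² = k * D * D

    y<kA² : y < kA²
    y<kA² = <-≤-trans (<1+m*n y A) (m≤m*n (k * A) A)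

    kA²<z : kA² < z
    kA²<z = *-monoʳ-< (k * A) {{m*n≢0 k A}} A<D

    z<kD² : z < kD²
    z<kD² = *-monoˡ-< D (*-monoʳ-< k A<D)

    y<z : y < z
    y<z = <-trans y<kA² kA²<z

    y<kD² : y < kD²
    y<kD² = <-trans y<z z<kD²

    kD²-completes : Contains (0 ∷ A ∷ D ∷ []) (kD² ∷ z ∷ 0 ∷ [])
    kD²-completes = Contains-dilate (k * D) {{m*n≢0 k D}}
      (there (there (here (*-zeroʳ (k * D)))) ∷ there (here (xy∙z≈xz∙y k D A)) ∷ here refl ∷ [])

    kA²-completes : Contains (0 ∷ A ∷ D ∷ []) (kA² ∷ z ∷ 0 ∷ [])
    kA²-completes = Contains-dilate (k * A) {{m*n≢0 k A}}
      (there (there (here (*-zeroʳ (k * A)))) ∷ here refl ∷ there (here refl) ∷ [])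

strictly-increasing : ∀ {xs} → Linked _≤_ xs → Unique xs → Linked _<_ xs
strictly-increasing []         _                    = []
strictly-increasing [-]        _                    = [-]
strictly-increasing (x≤y ∷ xs) ((x≢y ∷ _) ∷ unique) = ≤∧≢⇒< x≤y x≢y ∷ strictly-increasing xs unique

wins-increasing : ∀ {xs} → Linked _<_ xs → length xs ≤ 3 → HasMoveStrategy xs (length xs)
wins-increasing [] _ = Contains-dilate 1 []
wins-increasing [-] _ = translate-to-origin [] wins-singleton
wins-increasing (s<t ∷ [-]) _ =
  translate-to-origin (<⇒≤ s<t ∷ [])
    (wins-pair _ {{>-nonZero (m<n⇒0<n∸m s<t)}})
wins-increasing (s<t ∷ t<u ∷ [-]) _ =
  translate-to-origin (<⇒≤ s<t ∷ <⇒≤ (<-trans s<t t<u) ∷ [])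
    (wins-triple _ _ {{>-nonZero (m<n⇒0<n∸m s<t)}} (∸-monoˡ-< t<u (<⇒≤ s<t)))
wins-increasing (_ ∷ _ ∷ _ ∷ _) (s≤s (s≤s (s≤s ())))

corollary2p4 : (S : List ℕ) → Unique S → length S ≤ 3 →
    HasMoveStrategy S (length S)
corollary2p4 S unique |S|≤3 =
  subst (HasMoveStrategy S) sorted-length
    (WinsWithin-↭ (↭-sym (sort-↭ S))
      (wins-increasing
        (strictly-increasing (sort-↗ S) (Unique-resp-↭ (↭⇒↭ₛ (↭-sym (sort-↭ S))) unique))
        (subst (_≤ 3) (sym sorted-length) |S|≤3)))
  where
  sorted-length : length (sort S) ≡ length S
  sorted-length = ↭-length (sort-↭ S)
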